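{- Let $(G,V_1,V_2,V_3,k)$ be an instance of $3$-Layer Crossing Minimization. Let $u\in V_2$ and $i\in\{1,3\}$, and let $P_i(u)$ be the set of vertices of $V_i$ that have degree one in $G$ and are adjacent to $u$. Suppose $|P_i(u)|>k+1$ and let $v\in P_i(u)$ be arbitrary. Then $G$ admits a $3$-layer drawing respecting $(V_1,V_2,V_3)$ with at most $k$ crossings if and only if $G-v$ admits a $3$-layer drawing respecting the partition obtained by removing $v$ from $V_i$ with at most $k$ crossings.
   Context: An instance of $3$-Layer Crossing Minimization is $(G,V_1,V_2,V_3,k)$ where $(V_1,V_2,V_3)$ is a partition of $V(G)$ such that every edge has one endpoint in $V_1$ and the other in $V_2$, or one endpoint in $V_2$ and the other in $V_3$, and $k$ is a non-negative integer. A $3$-layer drawing respecting $(V_1,V_2,V_3)$ is a triple $(\sigma_1,\sigma_2,\sigma_3)$ of linear orders of $V_1,V_2,V_3$; two edges $u_1v_1,u_2v_2$ with $u_1,u_2\in V_{j-1}$, $v_1,v_2\in V_j$ cross if $\sigma_{j-1}(u_1)<\sigma_{j-1}(u_2)$ and $\sigma_j(v_1)>\sigma_j(v_2)$, or vice versa; the number of crossings is the number of crossing pairs of edges. -}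

module Defs where

open import Data.Nat using (ℕ; zero; suc; _+_; _<_; _<ᵇ_; _≡ᵇ_; _≤_)
open import Data.Bool using (Bool; true; false; _∧_; _∨_; if_then_else_)
open import Data.Fin using (Fin; punchIn)
open import Data.List using (List; map; allFin)
open import Data.Nat.ListAction using (sum)
open import Data.Product using (Σ; _×_; _,_)
open import Data.Sum using (_⊎_)
open import Relation.Binary.PropositionalEquality using (_≡_)

data Layer : Set where
  L₁ L₂ L₃ : Layer

_==L_ : Layer → Layer → Bool
L₁ ==L L₁ = true
L₂ ==L L₂ = true
L₃ ==L L₃ = true
_  ==L _  = false

consec : Layer → Layer → Bool
consec L₁ L₂ = true
consec L₂ L₃ = true
consec _  _  = false

record LGraph (n : ℕ) : Set where
  field
    adj   : Fin n → Fin n → Bool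
    layer : Fin n → Layer
open LGraph public

countF : ∀ {n} → (Fin n → Bool) → ℕ
countF {n} p = sum (map (λ x → if p x then 1 else 0) (allFin n))

IsInstance : ∀ {n} → LGraph n → Set
IsInstance {n} G =
  ((x y : Fin n) → adj G x y ≡ adj G y x) ×
  ((x y : Fin n) → adj G x y ≡ true →
     (consec (layer G x) (layer G y) ≡ true) ⊎ (consec (layer G y) (layer G x) ≡ true))

degree : ∀ {n} → LGraph n → Fin n → ℕ
degree G x = countF (adj G x)

inP : ∀ {n} → LGraph n → Layer → Fin n → Fin n → Bool
inP G i u w = (layer G w ==L i) ∧ ((degree G w ≡ᵇ 1) ∧ adj G u w)

sizeP : ∀ {n} → LGraph n → Layer → Fin n → ℕ
sizeP G i u = countF (inP G i u)

-- A 3-layer drawing respecting the partition: a position function that is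
-- injective on each layer; its restriction to V_j is the linear order σ_j.
IsDrawing : ∀ {n} → LGraph n → (Fin n → ℕ) → Set
IsDrawing {n} G σ =
  (x y : Fin n) → layer G x ≡ layer G y → σ x ≡ σ y → x ≡ y

-- An edge is written (a,b) with a in
-- layer V_{j-1}, b in V_j. Unordered pair {a₁b₁, a₂b₂} (same j) crosses iff
-- (σ a₁ < σ a₂ and σ b₁ > σ b₂) or vice versa; we count it once by requiring
-- σ a₁ < σ a₂.
crosses : ∀ {n} → LGraph n → (Fin n → ℕ) → Fin n → Fin n → Fin n → Fin n → Bool
crosses G σ a₁ b₁ a₂ b₂ =
  adj G a₁ b₁ ∧ adj G a₂ b₂ ∧ consec (layer G a₁) (layer G b₁)
  ∧ (layer G a₂ ==L layer G a₁) ∧ (layer G b₂ ==L layer G b₁)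
  ∧ (σ a₁ <ᵇ σ a₂) ∧ (σ b₂ <ᵇ σ b₁)

sumF : ∀ {n} → (Fin n → ℕ) → ℕ
sumF {n} f = sum (map f (allFin n))

crossings : ∀ {n} → LGraph n → (Fin n → ℕ) → ℕ
crossings G σ =
  sumF λ a₁ → sumF λ b₁ → sumF λ a₂ → countF λ b₂ → crosses G σ a₁ b₁ a₂ b₂

HasDrawing : ∀ {n} → LGraph n → ℕ → Set
HasDrawing {n} G k = Σ (Fin n → ℕ) λ σ → IsDrawing G σ × (crossings G σ ≤ k)

deleteV : ∀ {n} → LGraph (suc n) → Fin (suc n) → LGraph n
deleteV G v = record
  { adj   = λ x y → adj G (punchIn v x) (punchIn v y)
  ; layer = λ x → layer G (punchIn v x) }

module Submission where

-- Deleting v never creates crossings, so only the converse needs an argument.  The vertices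
-- of P_i(u) other than v remain pendant at u in G − v, and two edges at u never cross, so each
-- crossing of G − v passes through at most one of them.  A drawing of G − v with at most k
-- crossings therefore leaves some w ∈ P_i(u) on no crossing (double counting over the
-- crossings), since there are at least k + 1 candidates.  Re-insert v immediately next to w:
-- identifying v with w maps a crossing through v to a crossing through w, so none exists and
-- the drawing of G has exactly the crossings of the drawing of G − v.

open import Defs
open import Data.Bool using (Bool; true; false; _∧_; if_then_else_)
open import Data.Bool.Properties using (¬-not; T-≡)
import Data.Bool.Properties as Bool
open import Data.Empty using (⊥; ⊥-elim)
open import Data.Fin using (Fin; zero; suc; punchIn)
open import Data.Fin.Properties
  using (_≟_; any?; suc-injective; 0≢1+n; punchIn-punchOut; punchIn-injective; punchInᵢ≢i)
open import Data.List using (List; []; _∷_; map; tabulate)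
open import Data.List.Properties using (map-tabulate)
open import Data.List.Membership.Propositional using (_∈_; _∉_)
open import Data.List.Membership.Propositional.Properties using (∈-map⁺)
open import Data.List.Relation.Unary.Any using (here; there)
open import Data.Nat using (ℕ; zero; suc; _+_; _*_; _<_; _≤_; _<ᵇ_; z≤n)
import Data.Nat.ListAction as List
open import Data.Nat.Properties
  using ( ≤-refl; ≤-reflexive; ≤-trans; ≤-<-trans; <-trans; <-irrefl; n<1+n; m<1+n⇒m≤n; ≤∧≢⇒<
        ; ≤⇒≯; n≢0⇒n>0; m<n⇒n≢0; m≤m+n; m≤n+m; +-comm; +-mono-≤; +-monoˡ-≤; +-monoʳ-≤; +-cancelˡ-<
        ; *-monoʳ-<; *-cancelˡ-<; *-cancelˡ-≤; *-cancelˡ-≡; even≢odd; _<?_; <ᵇ⇒<; <⇒<ᵇ; ≡ᵇ⇒≡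
        ; +-0-commutativeMonoid; module ≤-Reasoning )
import Data.Nat.Properties as ℕ
open import Algebra.Properties.CommutativeMonoid.Sum +-0-commutativeMonoid
  using (sum; sum-remove; ∑-comm; sum-cong-≗; sum-replicate-zero)
open import Data.Product using (_×_; _,_; proj₂; ∃-syntax)
open import Data.Sum using (_⊎_; inj₁; inj₂)
open import Data.Vec.Functional using (insertAt)
open import Data.Vec.Functional.Properties using (insertAt-lookup; insertAt-punchIn)
open import Function using (id; _∘_; _⇔_; mk⇔; Equivalence)
open import Relation.Nullary using (Dec; does; yes; no; contradiction)
open import Relation.Nullary.Decidable using (_×-dec_; dec-true; does-⇔)
open import Relation.Binary.PropositionalEquality
  using (_≡_; _≢_; refl; sym; trans; cong; cong₂; subst; subst₂; module ≡-Reasoning)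

-- countF p unfolds to sumF (ind ∘ p) and crossings to a fourfold sum of ind, so the lemmas
-- about sumF below apply to both without conversion.
ind : Bool → ℕ
ind b = if b then 1 else 0

ind≤1 : ∀ b → ind b ≤ 1
ind≤1 true  = ≤-refl
ind≤1 false = z≤n

∧-true : ∀ {a b} → a ∧ b ≡ true → a ≡ true × b ≡ true
∧-true {true} b≡true = refl , b≡true

∧-true₃ : ∀ {a b c} → a ∧ b ∧ c ≡ true → a ≡ true × b ≡ true × c ≡ true
∧-true₃ {true} {true} c≡true = refl , refl , c≡true

does⇒ : ∀ {A : Set} (a? : Dec A) → does a? ≡ true → A
does⇒ (yes a) _ = a

<ᵇ-true⇒< : ∀ {m n} → (m <ᵇ n) ≡ true → m < n
<ᵇ-true⇒< {m} {n} m<ᵇn = <ᵇ⇒< m n (T-≡ .Equivalence.from m<ᵇn)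

<⇒<ᵇ-true : ∀ {m n} → m < n → (m <ᵇ n) ≡ true
<⇒<ᵇ-true m<n = T-≡ .Equivalence.to (<⇒<ᵇ m<n)

<ᵇ-cong : ∀ {m n m′ n′} → m < n ⇔ m′ < n′ → (m <ᵇ n) ≡ (m′ <ᵇ n′)
<ᵇ-cong {m} {n} {m′} {n′} iff = does-⇔ iff (m <? n) (m′ <? n′)

==L⇒≡ : ∀ {ℓ ℓ′} → (ℓ ==L ℓ′) ≡ true → ℓ ≡ ℓ′
==L⇒≡ {L₁} {L₁} _ = refl
==L⇒≡ {L₂} {L₂} _ = refl
==L⇒≡ {L₃} {L₃} _ = refl

≡⇒==L : ∀ {ℓ ℓ′} → ℓ ≡ ℓ′ → (ℓ ==L ℓ′) ≡ true
≡⇒==L {L₁} refl = refl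
≡⇒==L {L₂} refl = refl
≡⇒==L {L₃} refl = refl

consec⇒≢ : ∀ {ℓ ℓ′} → consec ℓ ℓ′ ≡ true → ℓ ≢ ℓ′
consec⇒≢ {L₁} {L₂} _ ()
consec⇒≢ {L₂} {L₃} _ ()

-- Sums over Fin n

sumF≡sum : ∀ {n} (f : Fin n → ℕ) → sumF f ≡ sum f
sumF≡sum f = trans (cong List.sum (map-tabulate id f)) (sum-tabulate f)
  where
  sum-tabulate : ∀ {n} (g : Fin n → ℕ) → List.sum (tabulate g) ≡ sum g
  sum-tabulate {zero}  g = refl
  sum-tabulate {suc n} g = cong (g zero +_) (sum-tabulate (g ∘ suc))

sumF-punchIn : ∀ {n} (f : Fin (suc n) → ℕ) v → sumF f ≡ f v + sumF (f ∘ punchIn v)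
sumF-punchIn f v = begin
  sumF f                      ≡⟨ sumF≡sum f ⟩
  sum f                       ≡⟨ sum-remove f ⟩
  f v + sum (f ∘ punchIn v)   ≡⟨ cong (f v +_) (sumF≡sum (f ∘ punchIn v)) ⟨
  f v + sumF (f ∘ punchIn v)  ∎
  where open ≡-Reasoning

sumF-cong : ∀ {n} {f g : Fin n → ℕ} → (∀ x → f x ≡ g x) → sumF f ≡ sumF g
sumF-cong {f = f} {g} f≗g = trans (sumF≡sum f) (trans (sum-cong-≗ f≗g) (sym (sumF≡sum g)))

sumF-zero : ∀ {n} (f : Fin n → ℕ) → (∀ x → f x ≡ 0) → sumF f ≡ 0
sumF-zero {n} f f≗0 =
  trans (sumF-cong {g = λ _ → 0} f≗0) (trans (sumF≡sum {n} (λ _ → 0)) (sum-replicate-zero n))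

sumF-comm : ∀ {m n} (f : Fin m → Fin n → ℕ) →
            sumF (λ x → sumF (f x)) ≡ sumF (λ y → sumF (λ x → f x y))
sumF-comm f = begin
  sumF (λ x → sumF (f x))          ≡⟨ sumF-cong (λ x → sumF≡sum (f x)) ⟩
  sumF (λ x → sum (f x))           ≡⟨ sumF≡sum (λ x → sum (f x)) ⟩
  sum (λ x → sum (f x))            ≡⟨ ∑-comm f ⟩
  sum (λ y → sum (λ x → f x y))    ≡⟨ sumF≡sum (λ y → sum (λ x → f x y)) ⟨
  sumF (λ y → sum (λ x → f x y))   ≡⟨ sumF-cong (λ y → sumF≡sum (λ x → f x y)) ⟨
  sumF (λ y → sumF (λ x → f x y))  ∎
  where open ≡-Reasoning

sumF-mono : ∀ {n} {f g : Fin n → ℕ} → (∀ x → f x ≤ g x) → sumF f ≤ sumF g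
sumF-mono {zero}  f≤g = z≤n
sumF-mono {suc n} {f} {g} f≤g = begin
  sumF f                   ≡⟨ sumF-punchIn f zero ⟩
  f zero + sumF (f ∘ suc)  ≤⟨ +-mono-≤ (f≤g zero) (sumF-mono (f≤g ∘ suc)) ⟩
  g zero + sumF (g ∘ suc)  ≡⟨ sumF-punchIn g zero ⟨
  sumF g                   ∎
  where open ≤-Reasoning

≤-sumF : ∀ {n} (f : Fin n → ℕ) x → f x ≤ sumF f
≤-sumF {suc n} f x = subst (f x ≤_) (sym (sumF-punchIn f x)) (m≤m+n (f x) _)

sumF-punchIn-≤ : ∀ {n} (f : Fin (suc n) → ℕ) v → sumF (f ∘ punchIn v) ≤ sumF f
sumF-punchIn-≤ f v = subst (sumF (f ∘ punchIn v) ≤_) (sym (sumF-punchIn f v)) (m≤n+m _ (f v))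

sumF-punchIn-mono : ∀ {n} {f : Fin n → ℕ} {g : Fin (suc n) → ℕ} v →
                    (∀ x → f x ≤ g (punchIn v x)) → sumF f ≤ sumF g
sumF-punchIn-mono {g = g} v f≤g = ≤-trans (sumF-mono f≤g) (sumF-punchIn-≤ g v)

sumF-punchIn-0 : ∀ {n} (f : Fin (suc n) → ℕ) v → f v ≡ 0 → sumF f ≡ sumF (f ∘ punchIn v)
sumF-punchIn-0 f v fv≡0 = trans (sumF-punchIn f v) (cong (_+ sumF (f ∘ punchIn v)) fv≡0)

countF≤1 : ∀ {n} (p : Fin n → Bool) → (∀ {x y} → p x ≡ true → p y ≡ true → x ≡ y) → countF p ≤ 1
countF≤1 {zero}  p unique = z≤n
countF≤1 {suc n} p unique =
  subst (_≤ 1) (sym (sumF-punchIn (ind ∘ p) zero)) (by-head (p zero) refl)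
  where
  by-head : ∀ t → p zero ≡ t → ind t + countF (p ∘ suc) ≤ 1
  by-head true  p0 = ≤-reflexive (cong suc (sumF-zero (ind ∘ p ∘ suc) λ x →
    cong ind (¬-not λ px → 0≢1+n (unique p0 px))))
  by-head false _  = countF≤1 (p ∘ suc) (λ px py → suc-injective (unique px py))

countF-punchIn-> : ∀ {n} (p : Fin (suc n) → Bool) v {k} → k + 1 < countF p → k < countF (p ∘ punchIn v)
countF-punchIn-> p v {k} k+1<p = +-cancelˡ-< 1 k _ (begin-strict
  1 + k                                ≡⟨ +-comm 1 k ⟩
  k + 1                                <⟨ k+1<p ⟩
  countF p                             ≡⟨ sumF-punchIn (ind ∘ p) v ⟩
  ind (p v) + countF (p ∘ punchIn v)   ≤⟨ +-monoˡ-≤ _ (ind≤1 (p v)) ⟩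
  1 + countF (p ∘ punchIn v)           ∎)
  where open ≤-Reasoning

-- Fourfold sums

Fun⁴ : ℕ → Set → Set
Fun⁴ n A = Fin n → Fin n → Fin n → Fin n → A

_∘⁴_ : ∀ {m n} {A : Set} → Fun⁴ m A → (Fin n → Fin m) → Fun⁴ n A
(F ∘⁴ f) a b c d = F (f a) (f b) (f c) (f d)

quad : ∀ {n} → Fin n → Fin n → Fin n → Fin n → List (Fin n)
quad a b c d = a ∷ b ∷ c ∷ d ∷ []

∑⁴ : ∀ {n} → Fun⁴ n ℕ → ℕ
∑⁴ F = sumF λ a → sumF λ b → sumF λ c → sumF λ d → F a b c d

module _ {n : ℕ} where

  ∑⁴-cong : {F G : Fun⁴ n ℕ} → (∀ a b c d → F a b c d ≡ G a b c d) → ∑⁴ F ≡ ∑⁴ G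
  ∑⁴-cong F≗G = sumF-cong λ a → sumF-cong λ b → sumF-cong λ c → sumF-cong λ d → F≗G a b c d

  ∑⁴-mono : {F G : Fun⁴ n ℕ} → (∀ a b c d → F a b c d ≤ G a b c d) → ∑⁴ F ≤ ∑⁴ G
  ∑⁴-mono F≤G = sumF-mono λ a → sumF-mono λ b → sumF-mono λ c → sumF-mono λ d → F≤G a b c d

  ≤-∑⁴ : (F : Fun⁴ n ℕ) (a b c d : Fin n) → F a b c d ≤ ∑⁴ F
  ≤-∑⁴ F a b c d = begin
    F a b c d                               ≤⟨ ≤-sumF (F a b c) d ⟩
    sumF (F a b c)                          ≤⟨ ≤-sumF (λ c → sumF (F a b c)) c ⟩
    sumF (λ c → sumF (F a b c))             ≤⟨ ≤-sumF (λ b → sumF λ c → sumF (F a b c)) b ⟩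
    sumF (λ b → sumF λ c → sumF (F a b c))  ≤⟨ ≤-sumF (λ a → sumF λ b → sumF λ c → sumF (F a b c)) a ⟩
    ∑⁴ F                                    ∎
    where open ≤-Reasoning

  sumF-∑⁴-comm : ∀ {m} (F : Fin m → Fun⁴ n ℕ) →
                 sumF (λ x → ∑⁴ (F x)) ≡ ∑⁴ (λ a b c d → sumF λ x → F x a b c d)
  sumF-∑⁴-comm F =
    trans (sumF-comm λ x a → sumF λ b → sumF λ c → sumF (F x a b c)) (sumF-cong λ a →
    trans (sumF-comm λ x b → sumF λ c → sumF (F x a b c)) (sumF-cong λ b →
    trans (sumF-comm λ x c → sumF (F x a b c)) (sumF-cong λ c →
    sumF-comm λ x → F x a b c)))

module _ {n : ℕ} (v : Fin (suc n)) where

  ∑⁴-punchIn-≤ : (F : Fun⁴ (suc n) ℕ) → ∑⁴ (F ∘⁴ punchIn v) ≤ ∑⁴ F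
  ∑⁴-punchIn-≤ F =
    sumF-punchIn-mono v λ a → sumF-punchIn-mono v λ b →
    sumF-punchIn-mono v λ c → sumF-punchIn-mono v λ d → ≤-refl

  ∑⁴-punchIn : (F : Fun⁴ (suc n) ℕ) → (∀ {a b c d} → v ∈ quad a b c d → F a b c d ≡ 0) →
               ∑⁴ F ≡ ∑⁴ (F ∘⁴ punchIn v)
  ∑⁴-punchIn F F≡0 =
    trans (sumF-punchIn-0 (λ a → sumF λ b → sumF λ c → sumF (F a b c)) v
            (sumF-zero (λ b → sumF λ c → sumF (F v b c)) λ b →
             sumF-zero (λ c → sumF (F v b c)) λ c →
             sumF-zero (F v b c) λ d → F≡0 (here refl))) (sumF-cong λ a →
    trans (sumF-punchIn-0 (λ b → sumF λ c → sumF (F (punchIn v a) b c)) v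
            (sumF-zero (λ c → sumF (F (punchIn v a) v c)) λ c →
             sumF-zero (F (punchIn v a) v c) λ d → F≡0 (there (here refl)))) (sumF-cong λ b →
    trans (sumF-punchIn-0 (λ c → sumF (F (punchIn v a) (punchIn v b) c)) v
            (sumF-zero (F (punchIn v a) (punchIn v b) v) λ d →
             F≡0 (there (there (here refl))))) (sumF-cong λ c →
    sumF-punchIn-0 (F (punchIn v a) (punchIn v b) (punchIn v c)) v
      (F≡0 (there (there (there (here refl))))))))

module _ {n : ℕ} (P : Fin n → Bool) (C : Fun⁴ n Bool) where

  open import Data.List.Membership.DecPropositional (_≟_ {n}) using (_∈?_)

  private
    touches : Fin n → Fun⁴ n Bool
    touches x a b c d = C a b c d ∧ P x ∧ does (x ∈? quad a b c d)

    load : Fin n → ℕ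
    load x = ∑⁴ λ a b c d → ind (touches x a b c d)

    touches⇒loaded : ∀ {x a b c d} → touches x a b c d ≡ true → 0 < load x
    touches⇒loaded {x} {a} {b} {c} {d} t =
      subst (_≤ load x) (cong ind t) (≤-∑⁴ (λ a b c d → ind (touches x a b c d)) a b c d)

  pigeonhole⁴ :
    (∀ {a b c d x y} → C a b c d ≡ true → P x ≡ true → P y ≡ true →
       x ∈ quad a b c d → y ∈ quad a b c d → x ≡ y) →
    ∑⁴ (λ a b c d → ind (C a b c d)) < countF P →
    ∃[ x ] P x ≡ true × (∀ {a b c d} → C a b c d ≡ true → x ∉ quad a b c d)
  pigeonhole⁴ unique fewer with any? (λ x → (P x Bool.≟ true) ×-dec (load x ℕ.≟ 0))
  ... | yes (x , Px , load≡0) = x , Px , λ {a} {b} {c} {d} Cq x∈q →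
    m<n⇒n≢0 (touches⇒loaded (cong₂ _∧_ Cq (cong₂ _∧_ Px (dec-true (x ∈? quad a b c d) x∈q)))) load≡0
  ... | no ¬free = contradiction fewer (≤⇒≯ (begin
    countF P                                          ≤⟨ sumF-mono P≤load ⟩
    sumF load                                         ≡⟨ sumF-∑⁴-comm (λ x a b c d → ind (touches x a b c d)) ⟩
    ∑⁴ (λ a b c d → countF λ x → touches x a b c d)  ≤⟨ ∑⁴-mono touching≤crosses ⟩
    ∑⁴ (λ a b c d → ind (C a b c d))                  ∎))
    where
    open ≤-Reasoning

    P≤load : ∀ x → ind (P x) ≤ load x
    P≤load x = by-membership (P x) refl
      where
      by-membership : ∀ t → P x ≡ t → ind t ≤ load x
      by-membership true  Px = n≢0⇒n>0 λ load≡0 → ¬free (x , Px , load≡0)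
      by-membership false _  = z≤n

    touching≤crosses : ∀ a b c d → countF (λ x → touches x a b c d) ≤ ind (C a b c d)
    touching≤crosses a b c d = by-crossing (C a b c d) refl
      where
      by-crossing : ∀ t → C a b c d ≡ t → countF (λ x → touches x a b c d) ≤ ind t
      by-crossing true  Cq = countF≤1 (λ x → touches x a b c d) λ tx ty →
        let _ , Px , x∈q = ∧-true₃ {C a b c d} tx
            _ , Py , y∈q = ∧-true₃ {C a b c d} ty
        in unique Cq Px Py (does⇒ (_ ∈? _) x∈q) (does⇒ (_ ∈? _) y∈q)
      by-crossing false Cq = ≤-reflexive (sumF-zero (λ x → ind (touches x a b c d)) λ x →
        cong (λ t → ind (t ∧ P x ∧ does (x ∈? quad a b c d))) Cq)

-- Crossings

record Crossing {n} (G : LGraph n) (σ : Fin n → ℕ) (a₁ b₁ a₂ b₂ : Fin n) : Set where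
  field
    edge₁       : adj G a₁ b₁ ≡ true
    edge₂       : adj G a₂ b₂ ≡ true
    consecutive : consec (layer G a₁) (layer G b₁) ≡ true
    tail-layer  : layer G a₂ ≡ layer G a₁
    head-layer  : layer G b₂ ≡ layer G b₁
    tail-order  : σ a₁ < σ a₂
    head-order  : σ b₂ < σ b₁

module _ {n} (G : LGraph n) (σ : Fin n → ℕ) where

  crosses⇒Crossing : ∀ {a₁ b₁ a₂ b₂} → crosses G σ a₁ b₁ a₂ b₂ ≡ true → Crossing G σ a₁ b₁ a₂ b₂
  crosses⇒Crossing {a₁} {b₁} {a₂} {b₂} c =
    let e₁ , c = ∧-true {adj G a₁ b₁} c
        e₂ , c = ∧-true {adj G a₂ b₂} c
        cs , c = ∧-true {consec (layer G a₁) (layer G b₁)} c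
        la , c = ∧-true {layer G a₂ ==L layer G a₁} c
        lb , c = ∧-true {layer G b₂ ==L layer G b₁} c
        oa , ob = ∧-true {σ a₁ <ᵇ σ a₂} c
    in record
      { edge₁ = e₁ ; edge₂ = e₂ ; consecutive = cs
      ; tail-layer = ==L⇒≡ la ; head-layer = ==L⇒≡ lb
      ; tail-order = <ᵇ-true⇒< oa ; head-order = <ᵇ-true⇒< ob }

  Crossing⇒crosses : ∀ {a₁ b₁ a₂ b₂} → Crossing G σ a₁ b₁ a₂ b₂ → crosses G σ a₁ b₁ a₂ b₂ ≡ true
  Crossing⇒crosses cr =
    cong₂ _∧_ edge₁ (cong₂ _∧_ edge₂ (cong₂ _∧_ consecutive
      (cong₂ _∧_ (≡⇒==L tail-layer) (cong₂ _∧_ (≡⇒==L head-layer)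
        (cong₂ _∧_ (<⇒<ᵇ-true tail-order) (<⇒<ᵇ-true head-order))))))
    where open Crossing cr

  Uncrossed : Fin n → Set
  Uncrossed x = ∀ {a₁ b₁ a₂ b₂} → Crossing G σ a₁ b₁ a₂ b₂ → x ∉ quad a₁ b₁ a₂ b₂

crossings-cong : ∀ {n} (G : LGraph n) {σ τ : Fin n → ℕ} →
                 (∀ x y → σ x < σ y ⇔ τ x < τ y) → crossings G σ ≡ crossings G τ
crossings-cong G same-order = ∑⁴-cong λ a₁ b₁ a₂ b₂ →
  cong (λ t → ind (adj G a₁ b₁ ∧ adj G a₂ b₂ ∧ consec (layer G a₁) (layer G b₁)
                   ∧ (layer G a₂ ==L layer G a₁) ∧ (layer G b₂ ==L layer G b₁) ∧ t))
       (cong₂ _∧_ (<ᵇ-cong (same-order a₁ a₂)) (<ᵇ-cong (same-order b₂ b₁)))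

module _ {n} (G : LGraph (suc n)) (v : Fin (suc n)) where

  deleteV-drawing : ∀ {σ} → IsDrawing G σ → IsDrawing (deleteV G v) (σ ∘ punchIn v)
  deleteV-drawing drawing x y same-layer same-position =
    punchIn-injective v x y (drawing _ _ same-layer same-position)

  crossings-deleteV-≤ : ∀ σ → crossings (deleteV G v) (σ ∘ punchIn v) ≤ crossings G σ
  crossings-deleteV-≤ σ = ∑⁴-punchIn-≤ v λ a₁ b₁ a₂ b₂ → ind (crosses G σ a₁ b₁ a₂ b₂)

  crossings-deleteV : ∀ σ → Uncrossed G σ v → crossings G σ ≡ crossings (deleteV G v) (σ ∘ punchIn v)
  crossings-deleteV σ v-free = ∑⁴-punchIn v (λ a₁ b₁ a₂ b₂ → ind (crosses G σ a₁ b₁ a₂ b₂)) λ v∈q →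
    cong ind (¬-not λ c → v-free (crosses⇒Crossing G σ c) v∈q)

-- Pendant vertices

data Punched {n} (v : Fin (suc n)) : Fin (suc n) → Set where
  at      : Punched v v
  punched : ∀ x → Punched v (punchIn v x)

punched? : ∀ {n} (v y : Fin (suc n)) → Punched v y
punched? v y with y ≟ v
... | yes refl = at
... | no y≢v   = subst (Punched v) (punchIn-punchOut (y≢v ∘ sym)) (punched _)

Pendant : ∀ {n} → LGraph n → Fin n → Fin n → Set
Pendant G u x = ∀ {y} → adj G x y ≡ true → y ≡ u

degree-one⇒pendant : ∀ {n} (G : LGraph n) {u x} → degree G x ≡ 1 → adj G x u ≡ true → Pendant G u x
degree-one⇒pendant {suc n} G {u} {x} degree≡1 xu {y} xy with punched? u y
... | at         = refl
... | punched y′ = contradiction (subst (2 ≤_) degree≡1 two≤degree) (<-irrefl refl)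
  where
  open ≤-Reasoning
  two≤degree : 2 ≤ degree G x
  two≤degree = begin
    ind true + ind true                             ≡⟨ cong₂ _+_ (cong ind xu) (cong ind xy) ⟨
    ind (adj G x u) + ind (adj G x (punchIn u y′))  ≤⟨ +-monoʳ-≤ _ (≤-sumF (ind ∘ adj G x ∘ punchIn u) y′) ⟩
    ind (adj G x u) + countF (adj G x ∘ punchIn u)  ≡⟨ sumF-punchIn (ind ∘ adj G x) u ⟨
    degree G x                                      ∎

inP-sound : ∀ {n} (G : LGraph n) → (∀ x y → adj G x y ≡ adj G y x) → ∀ {i u x} → inP G i u x ≡ true →
            layer G x ≡ i × adj G x u ≡ true × Pendant G u x
inP-sound G adj-sym {i} {u} {x} x∈P =
  let x∈i , degree≡1 , ux = ∧-true₃ {layer G x ==L i} x∈P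
      xu = trans (adj-sym x u) ux
  in ==L⇒≡ x∈i , xu , degree-one⇒pendant G (≡ᵇ⇒≡ _ 1 (T-≡ .Equivalence.from degree≡1)) xu

pendant-deleteV : ∀ {n} (G : LGraph (suc n)) v {u x} →
                  Pendant G (punchIn v u) (punchIn v x) → Pendant (deleteV G v) u x
pendant-deleteV G v pendant xy = punchIn-injective v _ _ (pendant xy)

pattern at-a₁ = here refl
pattern at-b₁ = there (here refl)
pattern at-a₂ = there (there (here refl))
pattern at-b₂ = there (there (there (here refl)))
pattern past-quad = there (there (there (there ())))

module _ {n} (G : LGraph n) (adj-sym : ∀ x y → adj G x y ≡ adj G y x)
         {σ a₁ b₁ a₂ b₂} (cr : Crossing G σ a₁ b₁ a₂ b₂) {u : Fin n} where

  open Crossing cr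

  private
    pendant-at : ∀ {x y} → Pendant G u x → adj G y x ≡ true → y ≡ u
    pendant-at {x} {y} pendant yx = pendant (trans (adj-sym x y) yx)

    edge-ends : ∀ {x y} → Pendant G u x → Pendant G u y → adj G x y ≡ true → x ≡ y
    edge-ends px py xy = trans (pendant-at py xy) (sym (px xy))

    ¬pendant-tails : Pendant G u a₁ → Pendant G u a₂ → ⊥
    ¬pendant-tails p₁ p₂ = <-irrefl (cong σ (trans (p₂ edge₂) (sym (p₁ edge₁)))) head-order

    ¬pendant-heads : Pendant G u b₁ → Pendant G u b₂ → ⊥
    ¬pendant-heads p₁ p₂ = <-irrefl (cong σ (trans (pendant-at p₁ edge₁) (sym (pendant-at p₂ edge₂)))) tail-order

    ¬pendant-a₁b₂ : Pendant G u a₁ → Pendant G u b₂ → ⊥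
    ¬pendant-a₁b₂ p₁ p₂ = consec⇒≢ consecutive (begin
      layer G a₁  ≡⟨ tail-layer ⟨
      layer G a₂  ≡⟨ cong (layer G) (trans (pendant-at p₂ edge₂) (sym (p₁ edge₁))) ⟩
      layer G b₁  ∎)
      where open ≡-Reasoning

    ¬pendant-a₂b₁ : Pendant G u a₂ → Pendant G u b₁ → ⊥
    ¬pendant-a₂b₁ p₂ p₁ = consec⇒≢ consecutive (begin
      layer G a₁  ≡⟨ cong (layer G) (trans (pendant-at p₁ edge₁) (sym (p₂ edge₂))) ⟩
      layer G b₂  ≡⟨ head-layer ⟩
      layer G b₁  ∎)
      where open ≡-Reasoning

  pendants-on-crossing-unique : ∀ {x y} → Pendant G u x → Pendant G u y →
                                x ∈ quad a₁ b₁ a₂ b₂ → y ∈ quad a₁ b₁ a₂ b₂ → x ≡ y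
  pendants-on-crossing-unique px py at-a₁ at-a₁ = refl
  pendants-on-crossing-unique px py at-a₁ at-b₁ = edge-ends px py edge₁
  pendants-on-crossing-unique px py at-a₁ at-a₂ = ⊥-elim (¬pendant-tails px py)
  pendants-on-crossing-unique px py at-a₁ at-b₂ = ⊥-elim (¬pendant-a₁b₂ px py)
  pendants-on-crossing-unique px py at-b₁ at-a₁ = sym (edge-ends py px edge₁)
  pendants-on-crossing-unique px py at-b₁ at-b₁ = refl
  pendants-on-crossing-unique px py at-b₁ at-a₂ = ⊥-elim (¬pendant-a₂b₁ py px)
  pendants-on-crossing-unique px py at-b₁ at-b₂ = ⊥-elim (¬pendant-heads px py)
  pendants-on-crossing-unique px py at-a₂ at-a₁ = ⊥-elim (¬pendant-tails py px)
  pendants-on-crossing-unique px py at-a₂ at-b₁ = ⊥-elim (¬pendant-a₂b₁ px py)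
  pendants-on-crossing-unique px py at-a₂ at-a₂ = refl
  pendants-on-crossing-unique px py at-a₂ at-b₂ = edge-ends px py edge₂
  pendants-on-crossing-unique px py at-b₂ at-a₁ = ⊥-elim (¬pendant-a₁b₂ py px)
  pendants-on-crossing-unique px py at-b₂ at-b₁ = ⊥-elim (¬pendant-heads py px)
  pendants-on-crossing-unique px py at-b₂ at-a₂ = sym (edge-ends py px edge₂)
  pendants-on-crossing-unique px py at-b₂ at-b₂ = refl
  pendants-on-crossing-unique px py past-quad _
  pendants-on-crossing-unique px py _ past-quad

-- Re-inserting a pendant vertex next to an uncrossed twin

module Reinsertion
  {n} (G : LGraph (suc n)) (adj-sym : ∀ x y → adj G x y ≡ adj G y x)
  (v : Fin (suc n)) (u w : Fin n)
  (v-pendant  : Pendant G (punchIn v u) v)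
  (w-pendant  : Pendant G (punchIn v u) (punchIn v w))
  (w-adj      : adj G (punchIn v w) (punchIn v u) ≡ true)
  (same-layer : layer G (punchIn v w) ≡ layer G v)
  (σ′ : Fin n → ℕ) (σ′-drawing : IsDrawing (deleteV G v) σ′)
  (w-free : Uncrossed (deleteV G v) σ′ w)
  where

  open import Data.List.Membership.DecPropositional (_≟_ {suc n}) using (_∈?_)

  private
    G′ = deleteV G v
    W  = punchIn v w

  -- Doubling leaves the odd position just after w free for v.
  σ : Fin (suc n) → ℕ
  σ = insertAt (λ x → 2 * σ′ x) v (suc (2 * σ′ w))

  merge : Fin (suc n) → Fin n
  merge = insertAt id v w

  private
    σ-v : σ v ≡ suc (2 * σ′ w)
    σ-v = insertAt-lookup _ v _

    σ-punchIn : ∀ x → σ (punchIn v x) ≡ 2 * σ′ x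
    σ-punchIn x = insertAt-punchIn _ v _ x

    merge-v : merge v ≡ w
    merge-v = insertAt-lookup _ v _

    merge-punchIn : ∀ x → merge (punchIn v x) ≡ x
    merge-punchIn x = insertAt-punchIn _ v _ x

    merge-layer : ∀ x → layer G′ (merge x) ≡ layer G x
    merge-layer x with punched? v x
    ... | at         rewrite merge-v          = same-layer
    ... | punched x′ rewrite merge-punchIn x′ = refl

    merge-adj : ∀ {x y} → adj G x y ≡ true → layer G x ≢ layer G y → adj G′ (merge x) (merge y) ≡ true
    merge-adj {x} {y} xy x≁y with punched? v x | punched? v y
    ... | at | at = contradiction refl x≁y
    ... | at | punched y′
      rewrite merge-v | merge-punchIn y′ | punchIn-injective v y′ u (v-pendant xy)
      = w-adj
    ... | punched x′ | at
      rewrite merge-v | merge-punchIn x′ | punchIn-injective v x′ u (v-pendant (trans (adj-sym v _) xy))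
      = trans (adj-sym _ _) w-adj
    ... | punched x′ | punched y′ rewrite merge-punchIn x′ | merge-punchIn y′ = xy

    merge-order : ∀ {x y} → layer G x ≡ layer G y → x ≢ W → σ x < σ y → σ′ (merge x) < σ′ (merge y)
    merge-order {x} {y} x~y x≢W x<y with punched? v x | punched? v y
    ... | at | at = contradiction x<y (<-irrefl refl)
    ... | at | punched y′ rewrite merge-v | merge-punchIn y′ =
      *-cancelˡ-< 2 _ _ (<-trans (n<1+n _) (subst₂ _<_ σ-v (σ-punchIn y′) x<y))
    ... | punched x′ | at rewrite merge-v | merge-punchIn x′ =
      ≤∧≢⇒< (*-cancelˡ-≤ 2 (m<1+n⇒m≤n (subst₂ _<_ (σ-punchIn x′) σ-v x<y))) λ same-position →
        x≢W (cong (punchIn v) (σ′-drawing x′ w (trans x~y (sym same-layer)) same-position))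
    ... | punched x′ | punched y′ rewrite merge-punchIn x′ | merge-punchIn y′ =
      *-cancelˡ-< 2 _ _ (subst₂ _<_ (σ-punchIn x′) (σ-punchIn y′) x<y)

    merge-crossing : ∀ {a₁ b₁ a₂ b₂} → Crossing G σ a₁ b₁ a₂ b₂ → W ∉ quad a₁ b₁ a₂ b₂ →
                     Crossing G′ σ′ (merge a₁) (merge b₁) (merge a₂) (merge b₂)
    merge-crossing {a₁} {b₁} {a₂} {b₂} cr W∉q = record
      { edge₁       = merge-adj edge₁ (consec⇒≢ consecutive)
      ; edge₂       = merge-adj edge₂ (subst₂ _≢_ (sym tail-layer) (sym head-layer) (consec⇒≢ consecutive))
      ; consecutive = subst₂ (λ ℓ ℓ′ → consec ℓ ℓ′ ≡ true) (sym (merge-layer a₁)) (sym (merge-layer b₁)) consecutive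
      ; tail-layer  = trans (merge-layer a₂) (trans tail-layer (sym (merge-layer a₁)))
      ; head-layer  = trans (merge-layer b₂) (trans head-layer (sym (merge-layer b₁)))
      ; tail-order  = merge-order (sym tail-layer) (λ a₁≡W → W∉q (here (sym a₁≡W))) tail-order
      ; head-order  = merge-order head-layer (λ b₂≡W → W∉q (there (there (there (here (sym b₂≡W)))))) head-order
      }
      where open Crossing cr

  drawing : IsDrawing G σ
  drawing x y x~y same-position with punched? v x | punched? v y
  ... | at | at = refl
  ... | at | punched y′ =
    contradiction (trans (sym (σ-punchIn y′)) (trans (sym same-position) σ-v)) (even≢odd (σ′ y′) (σ′ w))
  ... | punched x′ | at =
    contradiction (trans (sym (σ-punchIn x′)) (trans same-position σ-v)) (even≢odd (σ′ x′) (σ′ w))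
  ... | punched x′ | punched y′ = cong (punchIn v) (σ′-drawing x′ y′ x~y
          (*-cancelˡ-≡ _ _ 2 (trans (sym (σ-punchIn x′)) (trans same-position (σ-punchIn y′)))))

  v-uncrossed : Uncrossed G σ v
  v-uncrossed {a₁} {b₁} {a₂} {b₂} cr v∈q with W ∈? quad a₁ b₁ a₂ b₂
  ... | yes W∈q = punchInᵢ≢i v w (sym (pendants-on-crossing-unique G adj-sym cr v-pendant w-pendant v∈q W∈q))
  ... | no  W∉q = w-free (merge-crossing cr W∉q) (subst (_∈ map merge (quad a₁ b₁ a₂ b₂)) merge-v (∈-map⁺ merge v∈q))

  crossings-σ≡σ′ : crossings G σ ≡ crossings G′ σ′
  crossings-σ≡σ′ = trans (crossings-deleteV G v σ v-uncrossed) (crossings-cong G′ λ x y →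
    subst₂ (λ s t → s < t ⇔ σ′ x < σ′ y) (sym (σ-punchIn x)) (sym (σ-punchIn y))
      (mk⇔ (*-cancelˡ-< 2 _ _) (*-monoʳ-< 2)))

lemma6p1 : ∀ {n} (G : LGraph (suc n)) → IsInstance G → (k : ℕ)
           (u : Fin (suc n)) → layer G u ≡ L₂ →
           (i : Layer) → (i ≡ L₁ ⊎ i ≡ L₃) →
           k + 1 < sizeP G i u →
           (v : Fin (suc n)) → inP G i u v ≡ true →
           (HasDrawing G k ⇔ HasDrawing (deleteV G v) k)
lemma6p1 {n} G (adj-sym , _) k u u∈L₂ i i∈L₁₃ k+1<|P| v v∈P
  with v∈i , _ , v-pendant ← inP-sound G adj-sym v∈P
  with punched? v u
... | at = contradiction (trans (sym v∈i) u∈L₂) (i≢L₂ i∈L₁₃)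
  where
  i≢L₂ : i ≡ L₁ ⊎ i ≡ L₃ → i ≢ L₂
  i≢L₂ (inj₁ refl) ()
  i≢L₂ (inj₂ refl) ()
... | punched u′ = mk⇔ forward backward
  where
  G′ = deleteV G v
  P′ = inP G i u ∘ punchIn v

  forward : HasDrawing G k → HasDrawing G′ k
  forward (σ , σ-drawing , few) =
    σ ∘ punchIn v , deleteV-drawing G v σ-drawing , ≤-trans (crossings-deleteV-≤ G v σ) few

  leaves-unique : ∀ {σ′ a b c d x y} → crosses G′ σ′ a b c d ≡ true → P′ x ≡ true → P′ y ≡ true →
                  x ∈ quad a b c d → y ∈ quad a b c d → x ≡ y
  leaves-unique {σ′} c x∈P′ y∈P′ =
    pendants-on-crossing-unique G′ (λ x y → adj-sym (punchIn v x) (punchIn v y)) (crosses⇒Crossing G′ σ′ c)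
      (pendant-deleteV G v (proj₂ (proj₂ (inP-sound G adj-sym x∈P′))))
      (pendant-deleteV G v (proj₂ (proj₂ (inP-sound G adj-sym y∈P′))))

  backward : HasDrawing G′ k → HasDrawing G k
  backward (σ′ , σ′-drawing , few′) =
    let w , w∈P′ , w-free = pigeonhole⁴ P′ (crosses G′ σ′) (leaves-unique {σ′})
                              (≤-<-trans few′ (countF-punchIn-> (inP G i u) v k+1<|P|))
        w∈i , w-adj , w-pendant = inP-sound G adj-sym w∈P′
        open Reinsertion G adj-sym v u′ w v-pendant w-pendant w-adj (trans w∈i (sym v∈i))
                         σ′ σ′-drawing (w-free ∘ Crossing⇒crosses G′ σ′)
    in σ , drawing , subst (_≤ k) (sym crossings-σ≡σ′) few′
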